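{- Let $n\ge1$ be an integer, let $D=\{d\in\mathbb{Z}:1\le d\le n/2\}$, and treat $M(\gamma)$, $\gamma\in\{0,1\}^n$, as formal variables (so expressions are formal real linear combinations of them). For $j\in\{1,\dots,n\}$ let $\pi_j\in\{0,1\}^n$ have $1$ in coordinate $j$ and $0$ elsewhere, with addition in $\{0,1\}^n=\mathbb{Z}_2^n$ coordinatewise mod $2$. Then there exists no $n\times n$ circulant real Hadamard matrix if and only if there exist real weights $c_{\gamma,d}$ ($\gamma\in\{0,1\}^n$, $d\in D$) such that, as an identity of formal linear combinations, \[\sum_{\gamma\in\{0,1\}^n}\sum_{d\in D} c_{\gamma,d}\Big(\sum_{\substack{(j,k)\in\{1,\dots,n\}^2\\ j-k\equiv d\pmod n}} M(\gamma+\pi_j+\pi_k)\Big)=M(0).\]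
   Context: A real Hadamard matrix is a square $\pm1$ matrix with pairwise orthogonal rows. An $n\times n$ matrix $C$ is circulant if there is a vector $x$ with $c_{i,j}=x_{j-i+1}$, the index reduced modulo $n$ to $\{1,\dots,n\}$.
   Formalization: The weights $c_{\gamma,d}$ are taken in the rationals rather than the reals. -}

module Defs where

open import Data.Nat using (ℕ; zero; suc; NonZero) renaming (_+_ to _+ℕ_; _∸_ to _∸ℕ_)
open import Data.Nat.DivMod using (_%_; _/_; m%n<n)
open import Data.Fin using (Fin; toℕ; fromℕ<)
open import Data.Fin.Properties using () renaming (_≟_ to _≟F_)
open import Data.Bool using (Bool; true; false; _xor_; if_then_else_)
open import Data.Bool.Properties using () renaming (_≟_ to _≟B_)
open import Data.Vec using (Vec; []; _∷_; tabulate; zipWith; replicate)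
open import Data.Vec.Properties using (≡-dec)
open import Data.List using (List; []; _∷_; map; concatMap; foldr; applyUpTo; allFin)
open import Data.Integer using (ℤ) renaming (_+_ to _+ℤ_; _*_ to _*ℤ_)
import Data.Integer as ℤ
open import Data.Rational using (ℚ; 0ℚ; 1ℚ; _+_; _*_)
open import Data.Product using (Σ; _×_)
open import Data.Sum using (_⊎_)
open import Relation.Binary.PropositionalEquality using (_≡_; _≢_)
open import Relation.Nullary.Decidable using (⌊_⌋)
open import Data.Nat using () renaming (_≟_ to _≟ℕ_)

cdiff : (n : ℕ) → .{{_ : NonZero n}} → Fin n → Fin n → Fin n
cdiff n j i = fromℕ< (m%n<n (toℕ j +ℕ (n ∸ℕ toℕ i)) n)

-- Real Hadamard matrices (entries ±1, so integer-valued) and circulants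

PlusMinusOne : ℤ → Set
PlusMinusOne a = (a ≡ ℤ.1ℤ) ⊎ (a ≡ ℤ.-1ℤ)

sumℤ : {n : ℕ} → (Fin n → ℤ) → ℤ
sumℤ {n} f = foldr _+ℤ_ ℤ.0ℤ (map f (allFin n))

IsHadamard : (n : ℕ) → (Fin n → Fin n → ℤ) → Set
IsHadamard n H =
  ((i j : Fin n) → PlusMinusOne (H i j)) ×
  ((i j : Fin n) → i ≢ j → sumℤ (λ k → H i k *ℤ H j k) ≡ ℤ.0ℤ)

-- c_{i,j} = x_{j-i+1} (indices shifted to start at 0: c i j = x ((j - i) mod n))
IsCirculant : (n : ℕ) → .{{_ : NonZero n}} → (Fin n → Fin n → ℤ) → Set
IsCirculant n C = Σ (Fin n → ℤ) λ x → (i j : Fin n) → C i j ≡ x (cdiff n j i)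

-- Formal linear combinations of the variables M(γ), γ ∈ {0,1}^n,
-- represented by their coefficient functions Vec Bool n → ℚ.

allVecs : (n : ℕ) → List (Vec Bool n)
allVecs zero = [] ∷ []
allVecs (suc n) = concatMap (λ v → (false ∷ v) ∷ (true ∷ v) ∷ []) (allVecs n)

sumℚ : {A : Set} → List A → (A → ℚ) → ℚ
sumℚ xs f = foldr _+_ 0ℚ (map f xs)

π : {n : ℕ} → Fin n → Vec Bool n
π j = tabulate (λ i → ⌊ i ≟F j ⌋)

_⊕_ : {n : ℕ} → Vec Bool n → Vec Bool n → Vec Bool n
_⊕_ = zipWith _xor_

zeroVec : (n : ℕ) → Vec Bool n
zeroVec n = replicate n false

Dset : (n : ℕ) → List ℕ
Dset n = applyUpTo suc (n / 2)

indicator : Bool → ℚ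
indicator b = if b then 1ℚ else 0ℚ

-- Coefficient of M(μ) in  Σ_{(j,k), j-k ≡ d mod n} M(γ+π_j+π_k)
innerCoeff : (n : ℕ) → .{{_ : NonZero n}} → Vec Bool n → ℕ → Vec Bool n → ℚ
innerCoeff n γ d μ =
  sumℚ (allFin n) λ j → sumℚ (allFin n) λ k →
    indicator ⌊ toℕ (cdiff n j k) ≟ℕ (d % n) ⌋ *
    indicator ⌊ ≡-dec _≟B_ ((γ ⊕ π j) ⊕ π k) μ ⌋

-- Coefficient of M(μ) in Σ_γ Σ_{d∈D} c_{γ,d} (Σ_{(j,k), j-k≡d} M(γ+π_j+π_k))
lhsCoeff : (n : ℕ) → .{{_ : NonZero n}} → (Vec Bool n → ℕ → ℚ) → Vec Bool n → ℚ
lhsCoeff n c μ =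
  sumℚ (allVecs n) λ γ → sumℚ (Dset n) λ d → c γ d * innerCoeff n γ d μ

rhsCoeff : (n : ℕ) → Vec Bool n → ℚ
rhsCoeff n μ = indicator ⌊ ≡-dec _≟B_ (zeroVec n) μ ⌋

{-# OPTIONS --safe #-}
module Submission where

-- Substituting the character χ s μ = (-1)^(s·μ) of ℤ₂ⁿ for every variable M(μ) is linear, sends
-- M(0) to 1 and, because χ s (γ + π j + π k) = χ s γ · x j · x k with x j = (-1)^(s j), sends the
-- inner sum for the shift d to χ s γ · A_s(d), where A_s is the periodic autocorrelation of x.
-- The rows of the circulant matrix with first row x are orthogonal exactly when A_s vanishes at
-- every nonzero shift, and since A_s(d) = A_s(n - d) it is enough to check d ∈ D.  So a circulant
-- Hadamard matrix, through the character given by its first row, turns the identity into 0 = 1.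
-- If there is none, every s has a shift d_s ∈ D with A_s(d_s) ≠ 0, and by orthogonality of
-- characters c_{γ,d} = Σ_s [d = d_s] χ s γ / (2ⁿ A_s(d_s)) solves the identity.

open import Defs
open import Algebra.Bundles using (CommutativeMonoid)
import Algebra.Properties.CommutativeSemigroup as CommutativeSemigroupProperties
open import Data.Bool using (Bool; true; false; _∧_; _xor_)
open import Data.Bool.Properties
  using (∧-distribˡ-xor; ∧-zeroʳ; ∧-identityʳ; xor-assoc; xor-same; xor-identityʳ)
  renaming (_≟_ to _≟B_)
open import Data.Empty using (⊥-elim)
open import Data.Fin using (Fin; zero; suc; toℕ)
open import Data.Fin.Properties using (toℕ-injective; toℕ-fromℕ<; toℕ<n) renaming (_≟_ to _≟F_)
open import Data.Integer using (ℤ; 0ℤ; 1ℤ; -1ℤ) renaming (_+_ to _+ℤ_; _*_ to _*ℤ_)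
open import Data.Integer.Properties using () renaming (_≟_ to _≟ℤ_; *-identityʳ to *ℤ-identityʳ)
open import Data.List using (List; []; _∷_; _++_; map; foldr; concatMap; allFin)
open import Data.List.Membership.Propositional using (_∈_; find)
open import Data.List.Membership.Propositional.Properties using (∈-allFin; ∈-applyUpTo⁺; ∈-applyUpTo⁻)
open import Data.List.Relation.Unary.All as All using ([]; _∷_; all?)
open import Data.List.Relation.Unary.All.Properties using (¬All⇒Any¬)
open import Data.List.Relation.Unary.Any using (here; there)
open import Data.List.Relation.Unary.AllPairs using ([]; _∷_)
open import Data.List.Relation.Unary.Unique.Propositional using (Unique)
open import Data.List.Relation.Unary.Unique.Propositional.Properties using (allFin⁺; applyUpTo⁺₁)
open import Data.Nat as ℕ using (ℕ; zero; suc; NonZero; _∸_; _≤_; _<_; s≤s; z≤n; >-nonZero⁻¹; _≤?_)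
  renaming (_+_ to _+ℕ_; _*_ to _*ℕ_; _≟_ to _≟ℕ_)
import Data.Nat.Properties as ℕ
open import Data.Nat.DivMod
  using (_%_; _/_; _mod_; %-distribˡ-+; m%n%n≡m%n; [m+n]%n≡m%n; m%n<n; m%n≤n; m<n⇒m%n≡m;
         m≡m%n+[m/n]*n; m/n<m)
open import Data.Product using (Σ; _×_; _,_; proj₁; proj₂; ∃-syntax)
open import Data.Rational using (ℚ; 0ℚ; 1ℚ; ½; _+_; _*_; -_; 1/_; ≢-nonZero)
open import Data.Rational.Literals using (fromℤ)
open import Data.Rational.Properties
  using (1≢0; +-identityˡ; +-identityʳ; +-assoc; *-identityˡ; *-identityʳ; *-zeroˡ; *-zeroʳ;
         *-assoc; *-comm; *-distribˡ-+; *-inverseˡ; +-0-commutativeMonoid; *-1-commutativeMonoid;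
         toℚᵘ-injective; toℚᵘ-homo-+; toℚᵘ-homo-*)
  renaming (_≟_ to _≟ℚ_)
open import Data.Rational.Solver using (module +-*-Solver)
open import Data.Rational.Unnormalised using (*≡*)
open import Data.Rational.Unnormalised.Properties using (≃-trans; ≃-sym)
open import Data.Sum using (inj₁; inj₂)
open import Data.Vec using (Vec; []; _∷_; lookup; replicate; tabulate)
open import Data.Vec.Properties using (≡-dec; tabulate-cong; lookup∘tabulate)
open import Function using (_∘_; _⇔_; mk⇔)
open import Relation.Binary.Definitions using (DecidableEquality)
open import Relation.Binary.PropositionalEquality
open import Relation.Nullary using (¬_; Dec; yes; no; _×-dec_)
open import Relation.Nullary.Decidable using (⌊_⌋; ⌊⌋-map′; does-⇔; isYes≗does)

open ≡-Reasoning

private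
  module +ℚ = CommutativeSemigroupProperties (CommutativeMonoid.commutativeSemigroup +-0-commutativeMonoid)
  module *ℚ = CommutativeSemigroupProperties (CommutativeMonoid.commutativeSemigroup *-1-commutativeMonoid)

module _ {A : Set} where

  sum-cong : (xs : List A) {f g : A → ℚ} → (∀ x → f x ≡ g x) → sumℚ xs f ≡ sumℚ xs g
  sum-cong []       f≗g = refl
  sum-cong (x ∷ xs) f≗g = cong₂ _+_ (f≗g x) (sum-cong xs f≗g)

  sum-zero : (xs : List A) {f : A → ℚ} → (∀ {x} → x ∈ xs → f x ≡ 0ℚ) → sumℚ xs f ≡ 0ℚ
  sum-zero []       f≡0 = refl
  sum-zero (x ∷ xs) f≡0 = cong₂ _+_ (f≡0 (here refl)) (sum-zero xs (f≡0 ∘ there))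

  sum-*ˡ : ∀ a (xs : List A) f → a * sumℚ xs f ≡ sumℚ xs (λ x → a * f x)
  sum-*ˡ a []       f = *-zeroʳ a
  sum-*ˡ a (x ∷ xs) f = trans (*-distribˡ-+ a (f x) _) (cong (a * f x +_) (sum-*ˡ a xs f))

  sum-*ʳ : ∀ a (xs : List A) f → sumℚ xs f * a ≡ sumℚ xs (λ x → f x * a)
  sum-*ʳ a xs f = trans (*-comm _ a) (trans (sum-*ˡ a xs f) (sum-cong xs (λ x → *-comm a (f x))))

  sum-+ : (xs : List A) (f g : A → ℚ) → sumℚ xs (λ x → f x + g x) ≡ sumℚ xs f + sumℚ xs g
  sum-+ []       f g = refl
  sum-+ (x ∷ xs) f g =
    trans (cong (f x + g x +_) (sum-+ xs f g)) (+ℚ.interchange (f x) (g x) (sumℚ xs f) (sumℚ xs g))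

  sum-++ : (xs ys : List A) (f : A → ℚ) → sumℚ (xs ++ ys) f ≡ sumℚ xs f + sumℚ ys f
  sum-++ []       ys f = sym (+-identityˡ _)
  sum-++ (x ∷ xs) ys f = trans (cong (f x +_) (sum-++ xs ys f)) (sym (+-assoc (f x) _ _))

sum-swap : ∀ {A B : Set} (xs : List A) (ys : List B) (f : A → B → ℚ) →
           sumℚ xs (λ x → sumℚ ys (f x)) ≡ sumℚ ys (λ y → sumℚ xs (λ x → f x y))
sum-swap []       ys f = sym (sum-zero ys (λ _ → refl))
sum-swap (x ∷ xs) ys f = trans (cong (sumℚ ys (f x) +_) (sum-swap xs ys f)) (sym (sum-+ ys (f x) _))

sum-*ˡ-swap : ∀ {A B : Set} (xs : List A) (ys : List B) (a : B → ℚ) (f : B → A → ℚ) →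
              sumℚ ys (λ y → a y * sumℚ xs (f y)) ≡ sumℚ xs (λ x → sumℚ ys (λ y → a y * f y x))
sum-*ˡ-swap xs ys a f = trans (sum-cong ys (λ y → sum-*ˡ (a y) xs (f y))) (sum-swap ys xs _)

sum-concatMap : ∀ {A B : Set} (g : A → List B) (xs : List A) (f : B → ℚ) →
                sumℚ (concatMap g xs) f ≡ sumℚ xs (λ x → sumℚ (g x) f)
sum-concatMap g []       f = refl
sum-concatMap g (x ∷ xs) f =
  trans (sum-++ (g x) _ f) (cong (sumℚ (g x) f +_) (sum-concatMap g xs f))

module _ {P : Set} where

  indicator-yes : (p : Dec P) → P → indicator ⌊ p ⌋ ≡ 1ℚ
  indicator-yes (yes _) _ = refl
  indicator-yes (no ¬p) p = ⊥-elim (¬p p)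

  indicator-no : (p : Dec P) → ¬ P → indicator ⌊ p ⌋ ≡ 0ℚ
  indicator-no (yes p) ¬p = ⊥-elim (¬p p)
  indicator-no (no _)  _  = refl

module _ {P Q : Set} where

  indicator-cong : P ⇔ Q → (p : Dec P) (q : Dec Q) → indicator ⌊ p ⌋ ≡ indicator ⌊ q ⌋
  indicator-cong P⇔Q p q =
    cong indicator (trans (isYes≗does p) (trans (does-⇔ P⇔Q p q) (sym (isYes≗does q))))

  ⌊×-dec⌋ : (p : Dec P) (q : Dec Q) → ⌊ p ×-dec q ⌋ ≡ ⌊ p ⌋ ∧ ⌊ q ⌋
  ⌊×-dec⌋ (yes _) (yes _) = refl
  ⌊×-dec⌋ (yes _) (no _)  = refl
  ⌊×-dec⌋ (no _)  _       = refl

indicator-∧ : ∀ a b → indicator (a ∧ b) ≡ indicator a * indicator b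
indicator-∧ false false = refl
indicator-∧ false true  = refl
indicator-∧ true  false = refl
indicator-∧ true  true  = refl

module _ {A : Set} (_≟_ : DecidableEquality A) where

  sum-indicator : ∀ {xs} a (f : A → ℚ) → Unique xs → a ∈ xs →
                  sumℚ xs (λ x → indicator ⌊ a ≟ x ⌋ * f x) ≡ f a
  sum-indicator {a ∷ xs} a f (a∉xs ∷ _) (here refl) = begin
    indicator ⌊ a ≟ a ⌋ * f a + sumℚ xs (λ x → indicator ⌊ a ≟ x ⌋ * f x)
      ≡⟨ cong₂ _+_ (cong (_* f a) (indicator-yes (a ≟ a) refl)) (sum-zero xs absent) ⟩
    1ℚ * f a + 0ℚ
      ≡⟨ trans (+-identityʳ _) (*-identityˡ (f a)) ⟩
    f a ∎
    where
    absent : ∀ {x} → x ∈ xs → indicator ⌊ a ≟ x ⌋ * f x ≡ 0ℚ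
    absent {x} x∈xs =
      trans (cong (_* f x) (indicator-no (a ≟ x) (All.lookup a∉xs x∈xs))) (*-zeroˡ (f x))
  sum-indicator {x ∷ xs} a f (x∉xs ∷ unique) (there a∈xs) = begin
    indicator ⌊ a ≟ x ⌋ * f x + sumℚ xs (λ y → indicator ⌊ a ≟ y ⌋ * f y)
      ≡⟨ cong₂ _+_ (cong (_* f x) (indicator-no (a ≟ x) (All.lookup x∉xs a∈xs ∘ sym)))
                   (sum-indicator a f unique a∈xs) ⟩
    0ℚ * f x + f a
      ≡⟨ trans (cong (_+ f a) (*-zeroˡ (f x))) (+-identityˡ (f a)) ⟩
    f a ∎

sum-allFin-bijection : ∀ {n} (g h : Fin n → Fin n) → (∀ k → h (g k) ≡ k) → (∀ a → g (h a) ≡ a) →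
                       (f : Fin n → ℚ) → sumℚ (allFin n) (f ∘ g) ≡ sumℚ (allFin n) f
sum-allFin-bijection {n} g h hg gh f = begin
  sumℚ (allFin n) (f ∘ g)
    ≡⟨ sum-cong (allFin n) (λ k → sum-indicator _≟F_ (g k) f (allFin⁺ n) (∈-allFin (g k))) ⟨
  sumℚ (allFin n) (λ k → sumℚ (allFin n) (λ a → indicator ⌊ g k ≟F a ⌋ * f a))
    ≡⟨ sum-swap (allFin n) (allFin n) _ ⟩
  sumℚ (allFin n) (λ a → sumℚ (allFin n) (λ k → indicator ⌊ g k ≟F a ⌋ * f a))
    ≡⟨ sum-cong (allFin n) (λ a → sum-cong (allFin n) (λ k →
         cong (_* f a) (indicator-cong (inverse k a) (g k ≟F a) (h a ≟F k)))) ⟩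
  sumℚ (allFin n) (λ a → sumℚ (allFin n) (λ k → indicator ⌊ h a ≟F k ⌋ * f a))
    ≡⟨ sum-cong (allFin n) (λ a →
         sum-indicator _≟F_ (h a) (λ _ → f a) (allFin⁺ n) (∈-allFin (h a))) ⟩
  sumℚ (allFin n) f ∎
  where
  inverse : ∀ k a → (g k ≡ a) ⇔ (h a ≡ k)
  inverse k a = mk⇔ (λ { refl → hg k }) (λ { refl → gh a })

-- Characters of ℤ₂ⁿ

bools : List Bool
bools = false ∷ true ∷ []

bools-unique : Unique bools
bools-unique = ((λ ()) ∷ []) ∷ [] ∷ []

∈-bools : ∀ b → b ∈ bools
∈-bools false = here refl
∈-bools true  = there (here refl)

δ : ∀ {n} → Vec Bool n → Vec Bool n → ℚ
δ v w = indicator ⌊ ≡-dec _≟B_ v w ⌋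

δ-∷ : ∀ {n} a b (v w : Vec Bool n) → δ (a ∷ v) (b ∷ w) ≡ indicator ⌊ a ≟B b ⌋ * δ v w
δ-∷ a b v w = trans
  (cong indicator (trans (⌊⌋-map′ _ _ (a ≟B b ×-dec ≡-dec _≟B_ v w))
                         (⌊×-dec⌋ (a ≟B b) (≡-dec _≟B_ v w))))
  (indicator-∧ ⌊ a ≟B b ⌋ _)

sum-allVecs-δ : ∀ {n} (v : Vec Bool n) (f : Vec Bool n → ℚ) →
                sumℚ (allVecs n) (λ γ → δ v γ * f γ) ≡ f v
sum-allVecs-δ []              f = trans (+-identityʳ _) (*-identityˡ (f []))
sum-allVecs-δ {suc n} (b ∷ v) f = begin
  sumℚ (allVecs (suc n)) (λ γ → δ (b ∷ v) γ * f γ)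
    ≡⟨ sum-concatMap _ (allVecs n) _ ⟩
  sumℚ (allVecs n) (λ w → sumℚ bools (λ c → δ (b ∷ v) (c ∷ w) * f (c ∷ w)))
    ≡⟨ sum-cong (allVecs n) (λ w → sum-cong bools (λ c → split c w)) ⟩
  sumℚ (allVecs n) (λ w → sumℚ bools (λ c → δ v w * (indicator ⌊ b ≟B c ⌋ * f (c ∷ w))))
    ≡⟨ sum-cong (allVecs n) (λ w → sum-*ˡ (δ v w) bools (λ c → indicator ⌊ b ≟B c ⌋ * f (c ∷ w))) ⟨
  sumℚ (allVecs n) (λ w → δ v w * sumℚ bools (λ c → indicator ⌊ b ≟B c ⌋ * f (c ∷ w)))
    ≡⟨ sum-allVecs-δ v (λ w → sumℚ bools (λ c → indicator ⌊ b ≟B c ⌋ * f (c ∷ w))) ⟩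
  sumℚ bools (λ c → indicator ⌊ b ≟B c ⌋ * f (c ∷ v))
    ≡⟨ sum-indicator _≟B_ b (λ c → f (c ∷ v)) bools-unique (∈-bools b) ⟩
  f (b ∷ v) ∎
  where
  split : ∀ c w → δ (b ∷ v) (c ∷ w) * f (c ∷ w) ≡ δ v w * (indicator ⌊ b ≟B c ⌋ * f (c ∷ w))
  split c w = trans (cong (_* f (c ∷ w)) (δ-∷ b c v w))
                    (*ℚ.xy∙z≈y∙xz (indicator ⌊ b ≟B c ⌋) (δ v w) (f (c ∷ w)))

⊕-assoc : ∀ {n} (x y z : Vec Bool n) → (x ⊕ y) ⊕ z ≡ x ⊕ (y ⊕ z)
⊕-assoc []      []      []      = refl
⊕-assoc (a ∷ x) (b ∷ y) (c ∷ z) = cong₂ _∷_ (xor-assoc a b c) (⊕-assoc x y z)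

⊕-cancelʳ : ∀ {n} (x y : Vec Bool n) → (x ⊕ y) ⊕ y ≡ x
⊕-cancelʳ []      []      = refl
⊕-cancelʳ (a ∷ x) (b ∷ y) = cong₂ _∷_
  (trans (xor-assoc a b b) (trans (cong (a xor_) (xor-same b)) (xor-identityʳ a))) (⊕-cancelʳ x y)

⊕-⊕-swap : ∀ {n} {x y : Vec Bool n} (a b : Vec Bool n) → (x ⊕ a) ⊕ b ≡ y → (y ⊕ a) ⊕ b ≡ x
⊕-⊕-swap {x = x} a b refl = begin
  (((x ⊕ a) ⊕ b) ⊕ a) ⊕ b   ≡⟨ ⊕-assoc _ a b ⟩
  ((x ⊕ a) ⊕ b) ⊕ (a ⊕ b)   ≡⟨ cong (_⊕ (a ⊕ b)) (⊕-assoc x a b) ⟩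
  (x ⊕ (a ⊕ b)) ⊕ (a ⊕ b)   ≡⟨ ⊕-cancelʳ x (a ⊕ b) ⟩
  x                         ∎

tabulate-const : ∀ {A : Set} n (x : A) → tabulate (λ (_ : Fin n) → x) ≡ replicate n x
tabulate-const zero    x = refl
tabulate-const (suc n) x = cong (x ∷_) (tabulate-const n x)

π-zero : ∀ {n} → π {suc n} zero ≡ true ∷ zeroVec n
π-zero {n} = cong (true ∷_) (tabulate-const n false)

π-suc : ∀ {n} (j : Fin n) → π (suc j) ≡ false ∷ π j
π-suc j = cong (false ∷_) (tabulate-cong (λ i → ⌊⌋-map′ _ _ (i ≟F j)))

sign : Bool → ℚ
sign false = 1ℚ
sign true  = - 1ℚ

sign-xor : ∀ a b → sign (a xor b) ≡ sign a * sign b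
sign-xor false false = refl
sign-xor false true  = refl
sign-xor true  false = refl
sign-xor true  true  = refl

χ : ∀ {n} → Vec Bool n → Vec Bool n → ℚ
χ []      []      = 1ℚ
χ (a ∷ s) (b ∷ μ) = sign (a ∧ b) * χ s μ

χ-⊕ : ∀ {n} (s μ ν : Vec Bool n) → χ s (μ ⊕ ν) ≡ χ s μ * χ s ν
χ-⊕ []      []      []      = refl
χ-⊕ (a ∷ s) (b ∷ μ) (c ∷ ν) = begin
  sign (a ∧ (b xor c)) * χ s (μ ⊕ ν)
    ≡⟨ cong₂ _*_ (trans (cong sign (∧-distribˡ-xor a b c)) (sign-xor (a ∧ b) (a ∧ c))) (χ-⊕ s μ ν) ⟩
  (sign (a ∧ b) * sign (a ∧ c)) * (χ s μ * χ s ν)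
    ≡⟨ *ℚ.interchange (sign (a ∧ b)) (sign (a ∧ c)) (χ s μ) (χ s ν) ⟩
  (sign (a ∧ b) * χ s μ) * (sign (a ∧ c) * χ s ν) ∎

χ-zeroʳ : ∀ {n} (s : Vec Bool n) → χ s (zeroVec n) ≡ 1ℚ
χ-zeroʳ []      = refl
χ-zeroʳ (a ∷ s) = cong₂ _*_ (cong sign (∧-zeroʳ a)) (χ-zeroʳ s)

χ-π : ∀ {n} (s : Vec Bool n) (j : Fin n) → χ s (π j) ≡ sign (lookup s j)
χ-π (a ∷ s) zero = begin
  χ (a ∷ s) (π zero)                   ≡⟨ cong (χ (a ∷ s)) π-zero ⟩
  sign (a ∧ true) * χ s (zeroVec _)    ≡⟨ cong₂ _*_ (cong sign (∧-identityʳ a)) (χ-zeroʳ s) ⟩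
  sign a * 1ℚ                          ≡⟨ *-identityʳ (sign a) ⟩
  sign a                               ∎
χ-π (a ∷ s) (suc j) = begin
  χ (a ∷ s) (π (suc j))                ≡⟨ cong (χ (a ∷ s)) (π-suc j) ⟩
  sign (a ∧ false) * χ s (π j)         ≡⟨ cong₂ _*_ (cong sign (∧-zeroʳ a)) (χ-π s j) ⟩
  1ℚ * sign (lookup s j)               ≡⟨ *-identityˡ _ ⟩
  sign (lookup s j)                    ∎

½^_ : ℕ → ℚ
½^ zero  = 1ℚ
½^ suc n = ½ * ½^ n

χ-orthogonality : ∀ n (μ : Vec Bool n) → sumℚ (allVecs n) (λ s → ½^ n * χ s μ) ≡ rhsCoeff n μ
χ-orthogonality zero    []      = refl
χ-orthogonality (suc n) (b ∷ μ) = begin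
  sumℚ (allVecs (suc n)) (λ s → ½^ suc n * χ s (b ∷ μ))
    ≡⟨ sum-concatMap _ (allVecs n) _ ⟩
  sumℚ (allVecs n) (λ v → sumℚ bools (λ a → (½ * ½^ n) * (sign (a ∧ b) * χ v μ)))
    ≡⟨ sum-cong (allVecs n) (λ v → collect (½^ n) (sign b) (χ v μ)) ⟩
  sumℚ (allVecs n) (λ v → (½ * (1ℚ + sign b)) * (½^ n * χ v μ))
    ≡⟨ sum-*ˡ (½ * (1ℚ + sign b)) (allVecs n) (λ v → ½^ n * χ v μ) ⟨
  (½ * (1ℚ + sign b)) * sumℚ (allVecs n) (λ v → ½^ n * χ v μ)
    ≡⟨ cong₂ _*_ (½[1+sign] b) (χ-orthogonality n μ) ⟩
  indicator ⌊ false ≟B b ⌋ * rhsCoeff n μ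
    ≡⟨ δ-∷ false b (zeroVec n) μ ⟨
  rhsCoeff (suc n) (b ∷ μ) ∎
  where
  open +-*-Solver
  collect : ∀ h y x → (½ * h) * (1ℚ * x) + ((½ * h) * (y * x) + 0ℚ) ≡ (½ * (1ℚ + y)) * (h * x)
  collect = solve 3 (λ h y x → (con ½ :* h) :* (con 1ℚ :* x) :+ ((con ½ :* h) :* (y :* x) :+ con 0ℚ)
                             := (con ½ :* (con 1ℚ :+ y)) :* (h :* x)) refl
  ½[1+sign] : ∀ b → ½ * (1ℚ + sign b) ≡ indicator ⌊ false ≟B b ⌋
  ½[1+sign] false = refl
  ½[1+sign] true  = refl

-- Value of the formal combination with coefficient function F at M := h.
evaluate : ∀ {n} → (Vec Bool n → ℚ) → (Vec Bool n → ℚ) → ℚ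
evaluate {n} h F = sumℚ (allVecs n) (λ μ → h μ * F μ)

evaluate-rhsCoeff : ∀ {n} (h : Vec Bool n → ℚ) → evaluate h (rhsCoeff n) ≡ h (zeroVec n)
evaluate-rhsCoeff {n} h =
  trans (sum-cong (allVecs n) (λ μ → *-comm (h μ) (rhsCoeff n μ))) (sum-allVecs-δ (zeroVec n) h)

evaluate-δ : ∀ {n} (h : Vec Bool n → ℚ) a v → evaluate h (λ μ → a * δ v μ) ≡ a * h v
evaluate-δ {n} h a v = begin
  sumℚ (allVecs n) (λ μ → h μ * (a * δ v μ))
    ≡⟨ sum-cong (allVecs n) (λ μ → *ℚ.x∙yz≈y∙zx (h μ) a (δ v μ)) ⟩
  sumℚ (allVecs n) (λ μ → a * (δ v μ * h μ))
    ≡⟨ sum-*ˡ a (allVecs n) (λ μ → δ v μ * h μ) ⟨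
  a * sumℚ (allVecs n) (λ μ → δ v μ * h μ)
    ≡⟨ cong (a *_) (sum-allVecs-δ v h) ⟩
  a * h v ∎

fromℤ-injective : ∀ {a b} → fromℤ a ≡ fromℤ b → a ≡ b
fromℤ-injective = cong ℚ.numerator

fromℤ-+ : ∀ a b → fromℤ (a +ℤ b) ≡ fromℤ a + fromℤ b
fromℤ-+ a b = toℚᵘ-injective (≃-trans (*≡* a+b≡a+b) (≃-sym (toℚᵘ-homo-+ (fromℤ a) (fromℤ b))))
  where
  a+b≡a+b : (a +ℤ b) *ℤ 1ℤ ≡ (a *ℤ 1ℤ +ℤ b *ℤ 1ℤ) *ℤ 1ℤ
  a+b≡a+b = cong (_*ℤ 1ℤ) (sym (cong₂ _+ℤ_ (*ℤ-identityʳ a) (*ℤ-identityʳ b)))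

fromℤ-* : ∀ a b → fromℤ (a *ℤ b) ≡ fromℤ a * fromℤ b
fromℤ-* a b = toℚᵘ-injective (≃-trans (*≡* refl) (≃-sym (toℚᵘ-homo-* (fromℤ a) (fromℤ b))))

fromℤ-sum : ∀ {A : Set} (xs : List A) (f : A → ℤ) →
            fromℤ (foldr _+ℤ_ 0ℤ (map f xs)) ≡ sumℚ xs (fromℤ ∘ f)
fromℤ-sum []       f = refl
fromℤ-sum (x ∷ xs) f = trans (fromℤ-+ (f x) _) (cong (fromℤ (f x) +_) (fromℤ-sum xs f))

signℤ : Bool → ℤ
signℤ false = 1ℤ
signℤ true  = -1ℤ

signℤ-±1 : ∀ b → PlusMinusOne (signℤ b)
signℤ-±1 false = inj₁ refl
signℤ-±1 true  = inj₂ refl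

fromℤ-signℤ : ∀ b → fromℤ (signℤ b) ≡ sign b
fromℤ-signℤ false = refl
fromℤ-signℤ true  = refl

fromℤ-±1 : ∀ {a} → PlusMinusOne a → fromℤ a ≡ sign ⌊ a ≟ℤ -1ℤ ⌋
fromℤ-±1 (inj₁ refl) = refl
fromℤ-±1 (inj₂ refl) = refl

module _ (n : ℕ) .{{_ : NonZero n}} where

  -- Cyclic differences and autocorrelation

  infix 4 _≡ₙ_
  _≡ₙ_ : ℕ → ℕ → Set
  a ≡ₙ b = a % n ≡ b % n

  infixl 6 _⊖_
  _⊖_ : Fin n → Fin n → Fin n
  _⊖_ = cdiff n

  0ₙ : Fin n
  0ₙ = 0 mod n

  +-cong-≡ₙ : ∀ {a b c d} → a ≡ₙ b → c ≡ₙ d → a +ℕ c ≡ₙ b +ℕ d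
  +-cong-≡ₙ {a} {b} {c} {d} a≡b c≡d = begin
    (a +ℕ c) % n            ≡⟨ %-distribˡ-+ a c n ⟩
    (a % n +ℕ c % n) % n    ≡⟨ cong₂ (λ x y → (x +ℕ y) % n) a≡b c≡d ⟩
    (b % n +ℕ d % n) % n    ≡⟨ %-distribˡ-+ b d n ⟨
    (b +ℕ d) % n            ∎

  +-inverse-≡ₙ : ∀ a c → (a +ℕ c) +ℕ (n ∸ c % n) ≡ₙ a
  +-inverse-≡ₙ a c = begin
    ((a +ℕ c) +ℕ (n ∸ c % n)) % n
      ≡⟨ +-cong-≡ₙ (+-cong-≡ₙ {a} refl (sym (m%n%n≡m%n c n))) refl ⟩
    ((a +ℕ c % n) +ℕ (n ∸ c % n)) % n
      ≡⟨ cong (_% n) (trans (ℕ.+-assoc a _ _) (cong (a +ℕ_) (ℕ.m+[n∸m]≡n (m%n≤n c n)))) ⟩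
    (a +ℕ n) % n
      ≡⟨ [m+n]%n≡m%n a n ⟩
    a % n ∎

  +-cancelʳ-≡ₙ : ∀ a b c → a +ℕ c ≡ₙ b +ℕ c → a ≡ₙ b
  +-cancelʳ-≡ₙ a b c a+c≡b+c = begin
    a % n                           ≡⟨ +-inverse-≡ₙ a c ⟨
    ((a +ℕ c) +ℕ (n ∸ c % n)) % n   ≡⟨ +-cong-≡ₙ a+c≡b+c refl ⟩
    ((b +ℕ c) +ℕ (n ∸ c % n)) % n   ≡⟨ +-inverse-≡ₙ b c ⟩
    b % n                           ∎

  <-≡ₙ⇒≡ : ∀ {a b} → a < n → b < n → a ≡ₙ b → a ≡ b
  <-≡ₙ⇒≡ a<n b<n a≡b = trans (sym (m<n⇒m%n≡m a<n)) (trans a≡b (m<n⇒m%n≡m b<n))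

  toℕ-injective-≡ₙ : ∀ {i j : Fin n} → toℕ i ≡ₙ toℕ j → i ≡ j
  toℕ-injective-≡ₙ {i} {j} i≡j = toℕ-injective (<-≡ₙ⇒≡ (toℕ<n i) (toℕ<n j) i≡j)

  toℕ-mod : ∀ a → toℕ (a mod n) ≡ₙ a
  toℕ-mod a = trans (cong (_% n) (toℕ-fromℕ< (m%n<n a n))) (m%n%n≡m%n a n)

  ⊖-spec : ∀ j i → toℕ (j ⊖ i) +ℕ toℕ i ≡ₙ toℕ j
  ⊖-spec j i = begin
    (toℕ (j ⊖ i) +ℕ toℕ i) % n
      ≡⟨ +-cong-≡ₙ (toℕ-mod (toℕ j +ℕ (n ∸ toℕ i))) refl ⟩
    ((toℕ j +ℕ (n ∸ toℕ i)) +ℕ toℕ i) % n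
      ≡⟨ cong (_% n) (trans (ℕ.+-assoc (toℕ j) _ _)
                            (cong (toℕ j +ℕ_) (ℕ.m∸n+n≡m (ℕ.<⇒≤ (toℕ<n i))))) ⟩
    (toℕ j +ℕ n) % n
      ≡⟨ [m+n]%n≡m%n (toℕ j) n ⟩
    toℕ j % n ∎

  -- Every law of _⊖_ below follows from this characterisation of subtraction in ℤ/n.
  ⊖-unique : ∀ {j i t} → toℕ t +ℕ toℕ i ≡ₙ toℕ j → j ⊖ i ≡ t
  ⊖-unique {j} {i} {t} t+i≡j =
    toℕ-injective-≡ₙ (+-cancelʳ-≡ₙ _ _ (toℕ i) (trans (⊖-spec j i) (sym t+i≡j)))

  ⊖-involutive : ∀ j t → j ⊖ (j ⊖ t) ≡ t
  ⊖-involutive j t = ⊖-unique (trans (cong (_% n) (ℕ.+-comm (toℕ t) _)) (⊖-spec j t))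

  ⊖-identityʳ : ∀ j → j ⊖ 0ₙ ≡ j
  ⊖-identityʳ j =
    ⊖-unique (trans (+-cong-≡ₙ {toℕ j} refl (toℕ-mod 0)) (cong (_% n) (ℕ.+-identityʳ (toℕ j))))

  ⊖-cancelʳ : ∀ k l i → (k ⊖ i) ⊖ (l ⊖ i) ≡ k ⊖ l
  ⊖-cancelʳ k l i = ⊖-unique (+-cancelʳ-≡ₙ _ _ (toℕ i) (begin
    ((toℕ (k ⊖ l) +ℕ toℕ (l ⊖ i)) +ℕ toℕ i) % n
      ≡⟨ cong (_% n) (ℕ.+-assoc (toℕ (k ⊖ l)) _ (toℕ i)) ⟩
    (toℕ (k ⊖ l) +ℕ (toℕ (l ⊖ i) +ℕ toℕ i)) % n
      ≡⟨ +-cong-≡ₙ {toℕ (k ⊖ l)} refl (⊖-spec l i) ⟩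
    (toℕ (k ⊖ l) +ℕ toℕ l) % n
      ≡⟨ ⊖-spec k l ⟩
    toℕ k % n
      ≡⟨ ⊖-spec k i ⟨
    (toℕ (k ⊖ i) +ℕ toℕ i) % n ∎))

  ⊖≡0⇒≡ : ∀ {j i} → j ⊖ i ≡ 0ₙ → j ≡ i
  ⊖≡0⇒≡ {j} {i} j⊖i≡0 = begin
    j             ≡⟨ ⊖-identityʳ j ⟨
    j ⊖ 0ₙ        ≡⟨ cong (j ⊖_) j⊖i≡0 ⟨
    j ⊖ (j ⊖ i)   ≡⟨ ⊖-involutive j i ⟩
    i             ∎

  sum-translate : ∀ t (f : Fin n → ℚ) → sumℚ (allFin n) (λ k → f (k ⊖ t)) ≡ sumℚ (allFin n) f
  sum-translate t = sum-allFin-bijection (_⊖ t) (_⊖ (0ₙ ⊖ t)) (translate-back t)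
    (λ k → subst (λ u → k ⊖ (0ₙ ⊖ t) ⊖ u ≡ k) (⊖-involutive 0ₙ t) (translate-back (0ₙ ⊖ t) k))
    where
    translate-back : ∀ t k → k ⊖ t ⊖ (0ₙ ⊖ t) ≡ k
    translate-back t k = trans (⊖-cancelʳ k 0ₙ t) (⊖-identityʳ k)

  autocorrelation : (Fin n → ℚ) → Fin n → ℚ
  autocorrelation x t = sumℚ (allFin n) (λ j → x j * x (j ⊖ t))

  autocorrelation-rows : ∀ x i l →
    sumℚ (allFin n) (λ k → x (k ⊖ i) * x (k ⊖ l)) ≡ autocorrelation x (l ⊖ i)
  autocorrelation-rows x i l = begin
    sumℚ (allFin n) (λ k → x (k ⊖ i) * x (k ⊖ l))
      ≡⟨ sum-cong (allFin n) (λ k → cong (λ u → x (k ⊖ i) * x u) (⊖-cancelʳ k l i)) ⟨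
    sumℚ (allFin n) (λ k → x (k ⊖ i) * x ((k ⊖ i) ⊖ (l ⊖ i)))
      ≡⟨ sum-translate i (λ a → x a * x (a ⊖ (l ⊖ i))) ⟩
    autocorrelation x (l ⊖ i) ∎

  autocorrelation-negate : ∀ x t → autocorrelation x (0ₙ ⊖ t) ≡ autocorrelation x t
  autocorrelation-negate x t = begin
    autocorrelation x (0ₙ ⊖ t)
      ≡⟨ autocorrelation-rows x t 0ₙ ⟨
    sumℚ (allFin n) (λ k → x (k ⊖ t) * x (k ⊖ 0ₙ))
      ≡⟨ sum-cong (allFin n) (λ k → *-comm (x (k ⊖ t)) (x (k ⊖ 0ₙ))) ⟩
    sumℚ (allFin n) (λ k → x (k ⊖ 0ₙ) * x (k ⊖ t))
      ≡⟨ autocorrelation-rows x 0ₙ t ⟩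
    autocorrelation x (t ⊖ 0ₙ)
      ≡⟨ cong (autocorrelation x) (⊖-identityʳ t) ⟩
    autocorrelation x t ∎

  IsPerfect : (Fin n → ℚ) → Set
  IsPerfect x = ∀ t → t ≢ 0ₙ → autocorrelation x t ≡ 0ℚ

  Dset-unique : Unique (Dset n)
  Dset-unique = applyUpTo⁺₁ suc (n / 2) (λ i<j _ → ℕ.<⇒≢ i<j ∘ ℕ.suc-injective)

  ∈-Dset : ∀ {d} → 0 < d → d ≤ n / 2 → d ∈ Dset n
  ∈-Dset {suc i} _ i<n/2 = ∈-applyUpTo⁺ suc i<n/2

  Dset-nonzero : ∀ {d} → d ∈ Dset n → d mod n ≢ 0ₙ
  Dset-nonzero d∈D d≡0 with ∈-applyUpTo⁻ suc d∈D
  ... | i , i<n/2 , refl = ℕ.0≢1+n (sym (<-≡ₙ⇒≡ 1+i<n (>-nonZero⁻¹ n) (begin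
    suc i % n               ≡⟨ toℕ-mod (suc i) ⟨
    toℕ (suc i mod n) % n   ≡⟨ cong (λ u → toℕ u % n) d≡0 ⟩
    toℕ 0ₙ % n              ≡⟨ toℕ-mod 0 ⟩
    0 % n                   ∎)))
    where
    1+i<n : suc i < n
    1+i<n = ℕ.≤-<-trans i<n/2 (m/n<m n 2 (s≤s (s≤s z≤n)))

  toℕ-nonzero : ∀ {t} → t ≢ 0ₙ → 0 < toℕ t
  toℕ-nonzero t≢0 = ℕ.n≢0⇒n>0 (λ t≡0 →
    t≢0 (toℕ-injective-≡ₙ (trans (cong (_% n) t≡0) (sym (toℕ-mod 0)))))

  toℕ-negate : ∀ {t} → t ≢ 0ₙ → toℕ (0ₙ ⊖ t) ≡ n ∸ toℕ t
  toℕ-negate {t} t≢0 = <-≡ₙ⇒≡ (toℕ<n _) (ℕ.∸-monoʳ-< (toℕ-nonzero t≢0) (ℕ.<⇒≤ (toℕ<n t)))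
    (+-cancelʳ-≡ₙ _ _ (toℕ t) (begin
      (toℕ (0ₙ ⊖ t) +ℕ toℕ t) % n   ≡⟨ ⊖-spec 0ₙ t ⟩
      toℕ 0ₙ % n                    ≡⟨ toℕ-mod 0 ⟩
      0 % n                         ≡⟨ [m+n]%n≡m%n 0 n ⟨
      n % n                         ≡⟨ cong (_% n) (ℕ.m∸n+n≡m (ℕ.<⇒≤ (toℕ<n t))) ⟨
      (n ∸ toℕ t +ℕ toℕ t) % n      ∎))

  VanishesOnD : (Fin n → ℚ) → Set
  VanishesOnD x = ∀ {d} → d ∈ Dset n → autocorrelation x (d mod n) ≡ 0ℚ

  vanishesOnD-lower-half : ∀ x → VanishesOnD x →
                           ∀ t → t ≢ 0ₙ → toℕ t ≤ n / 2 → autocorrelation x t ≡ 0ℚ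
  vanishesOnD-lower-half x vanish t t≢0 t≤n/2 =
    subst (λ u → autocorrelation x u ≡ 0ℚ) (toℕ-injective-≡ₙ (toℕ-mod (toℕ t)))
          (vanish (∈-Dset (toℕ-nonzero t≢0) t≤n/2))

  n∸m≤n/2 : ∀ {m} → n / 2 < m → n ∸ m ≤ n / 2
  n∸m≤n/2 {m} n/2<m = ℕ.m≤n+o⇒m∸n≤o n m (ℕ.≤-trans n≤1+n/2+n/2 (ℕ.+-monoˡ-≤ (n / 2) n/2<m))
    where
    n≤1+n/2+n/2 : n ≤ suc (n / 2) +ℕ n / 2
    n≤1+n/2+n/2 = subst₂ _≤_ (sym (m≡m%n+[m/n]*n n 2))
      (cong suc (trans (ℕ.*-comm (n / 2) 2) (cong (n / 2 +ℕ_) (ℕ.+-identityʳ (n / 2)))))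
      (ℕ.+-monoˡ-≤ (n / 2 *ℕ 2) (ℕ.<⇒≤pred (m%n<n n 2)))

  vanishesOnD⇒perfect : ∀ x → VanishesOnD x → IsPerfect x
  vanishesOnD⇒perfect x vanish t t≢0 with toℕ t ≤? n / 2
  ... | yes t≤n/2 = vanishesOnD-lower-half x vanish t t≢0 t≤n/2
  ... | no  t≰n/2 = begin
    autocorrelation x t
      ≡⟨ autocorrelation-negate x t ⟨
    autocorrelation x (0ₙ ⊖ t)
      ≡⟨ vanishesOnD-lower-half x vanish (0ₙ ⊖ t) (t≢0 ∘ sym ∘ ⊖≡0⇒≡) -t≤n/2 ⟩
    0ℚ ∎
    where
    -t≤n/2 : toℕ (0ₙ ⊖ t) ≤ n / 2
    -t≤n/2 = subst (_≤ n / 2) (sym (toℕ-negate t≢0)) (n∸m≤n/2 (ℕ.≰⇒> t≰n/2))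

  -- Circulant Hadamard matrices and perfect sequences

  CirculantHadamard : Set
  CirculantHadamard = Σ (Fin n → Fin n → ℤ) (λ H → IsHadamard n H × IsCirculant n H)

  signs : Vec Bool n → Fin n → ℚ
  signs s j = sign (lookup s j)

  perfect⇒circulantHadamard : ∀ s → IsPerfect (signs s) → CirculantHadamard
  perfect⇒circulantHadamard s perfect = H , (entries , orthogonal) , (x , λ _ _ → refl)
    where
    x : Fin n → ℤ
    x j = signℤ (lookup s j)
    H : Fin n → Fin n → ℤ
    H i j = x (j ⊖ i)
    entries : ∀ i j → PlusMinusOne (H i j)
    entries i j = signℤ-±1 (lookup s (j ⊖ i))
    orthogonal : ∀ i l → i ≢ l → sumℤ (λ k → H i k *ℤ H l k) ≡ 0ℤ
    orthogonal i l i≢l = fromℤ-injective (begin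
      fromℤ (sumℤ (λ k → H i k *ℤ H l k))
        ≡⟨ fromℤ-sum (allFin n) _ ⟩
      sumℚ (allFin n) (λ k → fromℤ (H i k *ℤ H l k))
        ≡⟨ sum-cong (allFin n) (λ k → trans (fromℤ-* (H i k) (H l k))
             (cong₂ _*_ (fromℤ-signℤ (lookup s (k ⊖ i))) (fromℤ-signℤ (lookup s (k ⊖ l))))) ⟩
      sumℚ (allFin n) (λ k → signs s (k ⊖ i) * signs s (k ⊖ l))
        ≡⟨ autocorrelation-rows (signs s) i l ⟩
      autocorrelation (signs s) (l ⊖ i)
        ≡⟨ perfect (l ⊖ i) (i≢l ∘ sym ∘ ⊖≡0⇒≡) ⟩
      0ℚ ∎)

  circulantHadamard⇒perfect : CirculantHadamard → Σ (Vec Bool n) (IsPerfect ∘ signs)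
  circulantHadamard⇒perfect (H , (entries , orthogonal) , (x , circulant)) = s , perfect
    where
    s : Vec Bool n
    s = tabulate (λ j → ⌊ H 0ₙ j ≟ℤ -1ℤ ⌋)
    signs-s : ∀ j → signs s j ≡ fromℤ (H 0ₙ j)
    signs-s j = trans (cong sign (lookup∘tabulate _ j)) (sym (fromℤ-±1 (entries 0ₙ j)))
    row : ∀ t j → H t j ≡ H 0ₙ (j ⊖ t)
    row t j = trans (circulant t j) (sym (trans (circulant 0ₙ (j ⊖ t)) (cong x (⊖-identityʳ (j ⊖ t)))))
    perfect : IsPerfect (signs s)
    perfect t t≢0 = begin
      autocorrelation (signs s) t
        ≡⟨ sum-cong (allFin n) (λ j → cong₂ _*_ (signs-s j)
             (trans (signs-s (j ⊖ t)) (cong fromℤ (sym (row t j))))) ⟩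
      sumℚ (allFin n) (λ j → fromℤ (H 0ₙ j) * fromℤ (H t j))
        ≡⟨ sum-cong (allFin n) (λ j → fromℤ-* (H 0ₙ j) (H t j)) ⟨
      sumℚ (allFin n) (λ j → fromℤ (H 0ₙ j *ℤ H t j))
        ≡⟨ fromℤ-sum (allFin n) _ ⟨
      fromℤ (sumℤ (λ j → H 0ₙ j *ℤ H t j))
        ≡⟨ cong fromℤ (orthogonal 0ₙ t (t≢0 ∘ sym)) ⟩
      0ℚ ∎

  lag : Fin n → Fin n → ℕ → ℚ
  lag j k d = indicator ⌊ toℕ (j ⊖ k) ≟ℕ d % n ⌋

  sum-lag : ∀ x d → sumℚ (allFin n) (λ j → sumℚ (allFin n) (λ k → lag j k d * (x j * x k)))
                    ≡ autocorrelation x (d mod n)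
  sum-lag x d = sum-cong (allFin n) (λ j → begin
    sumℚ (allFin n) (λ k → lag j k d * (x j * x k))
      ≡⟨ sum-cong (allFin n) (λ k → cong (_* (x j * x k))
           (indicator-cong (partner j k) (toℕ (j ⊖ k) ≟ℕ d % n) (j ⊖ (d mod n) ≟F k))) ⟩
    sumℚ (allFin n) (λ k → indicator ⌊ j ⊖ (d mod n) ≟F k ⌋ * (x j * x k))
      ≡⟨ sum-indicator _≟F_ (j ⊖ (d mod n)) (λ k → x j * x k) (allFin⁺ n) (∈-allFin _) ⟩
    x j * x (j ⊖ (d mod n)) ∎)
    where
    partner : ∀ j k → (toℕ (j ⊖ k) ≡ d % n) ⇔ (j ⊖ (d mod n) ≡ k)
    partner j k = mk⇔
      (λ j⊖k≡d → trans (cong (j ⊖_) (sym (toℕ-injective (trans j⊖k≡d (sym (toℕ-fromℕ< _))))))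
                       (⊖-involutive j k))
      (λ { refl → trans (cong toℕ (⊖-involutive j (d mod n))) (toℕ-fromℕ< _) })

  innerCoeff-sym : ∀ γ d μ → innerCoeff n γ d μ ≡ innerCoeff n μ d γ
  innerCoeff-sym γ d μ = sum-cong (allFin n) (λ j → sum-cong (allFin n) (λ k →
    cong (lag j k d *_) (indicator-cong (mk⇔ (⊕-⊕-swap (π j) (π k)) (⊕-⊕-swap (π j) (π k))) _ _)))

  evaluate-innerCoeff : ∀ h γ d →
    evaluate h (innerCoeff n γ d)
    ≡ sumℚ (allFin n) (λ j → sumℚ (allFin n) (λ k → lag j k d * h ((γ ⊕ π j) ⊕ π k)))
  evaluate-innerCoeff h γ d = begin
    evaluate h (innerCoeff n γ d)
      ≡⟨ sum-*ˡ-swap (allFin n) (allVecs n) h _ ⟩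
    sumℚ (allFin n) (λ j → evaluate h (λ μ → sumℚ (allFin n) (λ k → lag j k d * δ (shifted j k) μ)))
      ≡⟨ sum-cong (allFin n) (λ j → sum-*ˡ-swap (allFin n) (allVecs n) h _) ⟩
    sumℚ (allFin n) (λ j → sumℚ (allFin n) (λ k → evaluate h (λ μ → lag j k d * δ (shifted j k) μ)))
      ≡⟨ sum-cong (allFin n) (λ j → sum-cong (allFin n) (λ k → evaluate-δ h (lag j k d) (shifted j k))) ⟩
    sumℚ (allFin n) (λ j → sumℚ (allFin n) (λ k → lag j k d * h (shifted j k))) ∎
    where
    shifted : Fin n → Fin n → Vec Bool n
    shifted j k = (γ ⊕ π j) ⊕ π k

  evaluate-χ-innerCoeff : ∀ s γ d →
    evaluate (χ s) (innerCoeff n γ d) ≡ χ s γ * autocorrelation (signs s) (d mod n)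
  evaluate-χ-innerCoeff s γ d = begin
    evaluate (χ s) (innerCoeff n γ d)
      ≡⟨ evaluate-innerCoeff (χ s) γ d ⟩
    sumℚ (allFin n) (λ j → sumℚ (allFin n) (λ k → lag j k d * χ s ((γ ⊕ π j) ⊕ π k)))
      ≡⟨ sum-cong (allFin n) (λ j →
           trans (sum-cong (allFin n) (factor j)) (sym (sum-*ˡ (χ s γ) (allFin n) _))) ⟩
    sumℚ (allFin n) (λ j → χ s γ * sumℚ (allFin n) (λ k → lag j k d * (signs s j * signs s k)))
      ≡⟨ sum-*ˡ (χ s γ) (allFin n) _ ⟨
    χ s γ * sumℚ (allFin n) (λ j → sumℚ (allFin n) (λ k → lag j k d * (signs s j * signs s k)))
      ≡⟨ cong (χ s γ *_) (sum-lag (signs s) d) ⟩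
    χ s γ * autocorrelation (signs s) (d mod n) ∎
    where
    factor : ∀ j k → lag j k d * χ s ((γ ⊕ π j) ⊕ π k) ≡ χ s γ * (lag j k d * (signs s j * signs s k))
    factor j k = begin
      lag j k d * χ s ((γ ⊕ π j) ⊕ π k)
        ≡⟨ cong (lag j k d *_)
             (trans (χ-⊕ s (γ ⊕ π j) (π k)) (cong (_* χ s (π k)) (χ-⊕ s γ (π j)))) ⟩
      lag j k d * ((χ s γ * χ s (π j)) * χ s (π k))
        ≡⟨ cong (lag j k d *_) (*-assoc (χ s γ) (χ s (π j)) (χ s (π k))) ⟩
      lag j k d * (χ s γ * (χ s (π j) * χ s (π k)))
        ≡⟨ *ℚ.x∙yz≈y∙xz (lag j k d) (χ s γ) _ ⟩
      χ s γ * (lag j k d * (χ s (π j) * χ s (π k)))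
        ≡⟨ cong (λ u → χ s γ * (lag j k d * u)) (cong₂ _*_ (χ-π s j) (χ-π s k)) ⟩
      χ s γ * (lag j k d * (signs s j * signs s k)) ∎

  sum-χ-innerCoeff : ∀ s d μ → sumℚ (allVecs n) (λ γ → χ s γ * innerCoeff n γ d μ)
                               ≡ χ s μ * autocorrelation (signs s) (d mod n)
  sum-χ-innerCoeff s d μ =
    trans (sum-cong (allVecs n) (λ γ → cong (χ s γ *_) (innerCoeff-sym γ d μ))) (evaluate-χ-innerCoeff s μ d)

  evaluate-lhsCoeff : ∀ h c →
    evaluate h (lhsCoeff n c)
    ≡ sumℚ (allVecs n) (λ γ → sumℚ (Dset n) (λ d → c γ d * evaluate h (innerCoeff n γ d)))
  evaluate-lhsCoeff h c = begin
    evaluate h (lhsCoeff n c)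
      ≡⟨ sum-*ˡ-swap (allVecs n) (allVecs n) h _ ⟩
    sumℚ (allVecs n) (λ γ → evaluate h (λ μ → sumℚ (Dset n) (λ d → c γ d * innerCoeff n γ d μ)))
      ≡⟨ sum-cong (allVecs n) (λ γ → sum-*ˡ-swap (Dset n) (allVecs n) h _) ⟩
    sumℚ (allVecs n) (λ γ → sumℚ (Dset n) (λ d → evaluate h (λ μ → c γ d * innerCoeff n γ d μ)))
      ≡⟨ sum-cong (allVecs n) (λ γ → sum-cong (Dset n) (λ d →
           trans (sum-cong (allVecs n) (λ μ → *ℚ.x∙yz≈y∙xz (h μ) (c γ d) _))
                 (sym (sum-*ˡ (c γ d) (allVecs n) _)))) ⟩
    sumℚ (allVecs n) (λ γ → sumℚ (Dset n) (λ d → c γ d * evaluate h (innerCoeff n γ d))) ∎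

  -- Certificates

  Certificate : Set
  Certificate = Σ (Vec Bool n → ℕ → ℚ) (λ c → (μ : Vec Bool n) → lhsCoeff n c μ ≡ rhsCoeff n μ)

  certificate⇒no-circulantHadamard : Certificate → ¬ CirculantHadamard
  certificate⇒no-circulantHadamard (c , lhs≡rhs) ch with circulantHadamard⇒perfect ch
  ... | s , perfect = 1≢0 (begin
    1ℚ                           ≡⟨ χ-zeroʳ s ⟨
    χ s (zeroVec n)              ≡⟨ evaluate-rhsCoeff (χ s) ⟨
    evaluate (χ s) (rhsCoeff n)  ≡⟨ sum-cong (allVecs n) (λ μ → cong (χ s μ *_) (lhs≡rhs μ)) ⟨
    evaluate (χ s) (lhsCoeff n c)
      ≡⟨ evaluate-lhsCoeff (χ s) c ⟩
    sumℚ (allVecs n) (λ γ → sumℚ (Dset n) (λ d → c γ d * evaluate (χ s) (innerCoeff n γ d)))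
      ≡⟨ sum-zero (allVecs n) (λ {γ} _ → sum-zero (Dset n) (vanishes γ)) ⟩
    0ℚ ∎)
    where
    vanishes : ∀ γ {d} → d ∈ Dset n → c γ d * evaluate (χ s) (innerCoeff n γ d) ≡ 0ℚ
    vanishes γ {d} d∈D = begin
      c γ d * evaluate (χ s) (innerCoeff n γ d)
        ≡⟨ cong (c γ d *_) (evaluate-χ-innerCoeff s γ d) ⟩
      c γ d * (χ s γ * autocorrelation (signs s) (d mod n))
        ≡⟨ cong (λ u → c γ d * (χ s γ * u)) (perfect _ (Dset-nonzero d∈D)) ⟩
      c γ d * (χ s γ * 0ℚ)
        ≡⟨ trans (cong (c γ d *_) (*-zeroʳ (χ s γ))) (*-zeroʳ (c γ d)) ⟩
      0ℚ ∎

  certificate : (Vec Bool n → ℕ) → (Vec Bool n → ℚ) → Vec Bool n → ℕ → ℚ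
  certificate shift w γ d = sumℚ (allVecs n) (λ s → indicator ⌊ shift s ≟ℕ d ⌋ * (w s * χ s γ))

  lhsCoeff-certificate : ∀ shift w → (∀ s → shift s ∈ Dset n) → ∀ μ →
    lhsCoeff n (certificate shift w) μ
    ≡ sumℚ (allVecs n) (λ s → w s * (χ s μ * autocorrelation (signs s) (shift s mod n)))
  lhsCoeff-certificate shift w shift∈D μ = begin
    lhsCoeff n (certificate shift w) μ
      ≡⟨ sum-cong (allVecs n) (λ γ → sum-cong (Dset n) (λ d →
           sum-*ʳ (innerCoeff n γ d μ) (allVecs n) _)) ⟩
    sumℚ (allVecs n) (λ γ → sumℚ (Dset n) (λ d → sumℚ (allVecs n) (λ s → term s γ d)))
      ≡⟨ sum-cong (allVecs n) (λ γ → sum-swap (Dset n) (allVecs n) _) ⟩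
    sumℚ (allVecs n) (λ γ → sumℚ (allVecs n) (λ s → sumℚ (Dset n) (term s γ)))
      ≡⟨ sum-swap (allVecs n) (allVecs n) _ ⟩
    sumℚ (allVecs n) (λ s → sumℚ (allVecs n) (λ γ → sumℚ (Dset n) (term s γ)))
      ≡⟨ sum-cong (allVecs n) (λ s → sum-cong (allVecs n) (pick s)) ⟩
    sumℚ (allVecs n) (λ s → sumℚ (allVecs n) (λ γ → w s * (χ s γ * innerCoeff n γ (shift s) μ)))
      ≡⟨ sum-cong (allVecs n) (λ s → sum-*ˡ (w s) (allVecs n) _) ⟨
    sumℚ (allVecs n) (λ s → w s * sumℚ (allVecs n) (λ γ → χ s γ * innerCoeff n γ (shift s) μ))
      ≡⟨ sum-cong (allVecs n) (λ s → cong (w s *_) (sum-χ-innerCoeff s (shift s) μ)) ⟩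
    sumℚ (allVecs n) (λ s → w s * (χ s μ * autocorrelation (signs s) (shift s mod n))) ∎
    where
    term : Vec Bool n → Vec Bool n → ℕ → ℚ
    term s γ d = (indicator ⌊ shift s ≟ℕ d ⌋ * (w s * χ s γ)) * innerCoeff n γ d μ
    pick : ∀ s γ → sumℚ (Dset n) (term s γ) ≡ w s * (χ s γ * innerCoeff n γ (shift s) μ)
    pick s γ = begin
      sumℚ (Dset n) (term s γ)
        ≡⟨ sum-cong (Dset n) (λ d →
             *-assoc (indicator ⌊ shift s ≟ℕ d ⌋) (w s * χ s γ) (innerCoeff n γ d μ)) ⟩
      sumℚ (Dset n) (λ d → indicator ⌊ shift s ≟ℕ d ⌋ * ((w s * χ s γ) * innerCoeff n γ d μ))
        ≡⟨ sum-indicator _≟ℕ_ (shift s) (λ d → (w s * χ s γ) * innerCoeff n γ d μ)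
                         Dset-unique (shift∈D s) ⟩
      (w s * χ s γ) * innerCoeff n γ (shift s) μ
        ≡⟨ *-assoc (w s) (χ s γ) _ ⟩
      w s * (χ s γ * innerCoeff n γ (shift s) μ) ∎

  nonvanishing-shift : ¬ CirculantHadamard →
                       ∀ s → ∃[ d ] d ∈ Dset n × autocorrelation (signs s) (d mod n) ≢ 0ℚ
  nonvanishing-shift noH s with all? (λ d → autocorrelation (signs s) (d mod n) ≟ℚ 0ℚ) (Dset n)
  ... | yes vanish =
    ⊥-elim (noH (perfect⇒circulantHadamard s (vanishesOnD⇒perfect (signs s) (All.lookup vanish))))
  ... | no ¬vanish = find (¬All⇒Any¬ (λ d → autocorrelation (signs s) (d mod n) ≟ℚ 0ℚ) (Dset n) ¬vanish)

  no-circulantHadamard⇒certificate : ¬ CirculantHadamard → Certificate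
  no-circulantHadamard⇒certificate noH = certificate shift w , λ μ → begin
    lhsCoeff n (certificate shift w) μ
      ≡⟨ lhsCoeff-certificate shift w (proj₁ ∘ proj₂ ∘ nonvanishing-shift noH) μ ⟩
    sumℚ (allVecs n) (λ s → w s * (χ s μ * a s))
      ≡⟨ sum-cong (allVecs n) (λ s → normalise s μ) ⟩
    sumℚ (allVecs n) (λ s → ½^ n * χ s μ)
      ≡⟨ χ-orthogonality n μ ⟩
    rhsCoeff n μ ∎
    where
    shift : Vec Bool n → ℕ
    shift s = proj₁ (nonvanishing-shift noH s)
    a : Vec Bool n → ℚ
    a s = autocorrelation (signs s) (shift s mod n)
    a≢0 : ∀ s → a s ≢ 0ℚ
    a≢0 s = proj₂ (proj₂ (nonvanishing-shift noH s))
    a⁻¹ : Vec Bool n → ℚ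
    a⁻¹ s = (1/ a s) {{≢-nonZero (a≢0 s)}}
    w : Vec Bool n → ℚ
    w s = ½^ n * a⁻¹ s
    normalise : ∀ s μ → w s * (χ s μ * a s) ≡ ½^ n * χ s μ
    normalise s μ = begin
      w s * (χ s μ * a s)
        ≡⟨ *ℚ.interchange (½^ n) (a⁻¹ s) (χ s μ) (a s) ⟩
      (½^ n * χ s μ) * (a⁻¹ s * a s)
        ≡⟨ cong ((½^ n * χ s μ) *_) (*-inverseˡ (a s) {{≢-nonZero (a≢0 s)}}) ⟩
      (½^ n * χ s μ) * 1ℚ
        ≡⟨ *-identityʳ (½^ n * χ s μ) ⟩
      ½^ n * χ s μ ∎

corollary1 : (m : ℕ) →
    (¬ Σ (Fin (suc m) → Fin (suc m) → ℤ)
          (λ H → IsHadamard (suc m) H × IsCirculant (suc m) H))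
    ⇔ Σ (Vec Bool (suc m) → ℕ → ℚ)
          (λ c → (μ : Vec Bool (suc m)) → lhsCoeff (suc m) c μ ≡ rhsCoeff (suc m) μ)
corollary1 m = mk⇔ (no-circulantHadamard⇒certificate (suc m)) (certificate⇒no-circulantHadamard (suc m))
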